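{- Let $w\in S_n$, $a:=w(1)$, $b\in[n]$ with $b\ge a$, and $p$ an integer with $0\le p<w^{ -1}(b)-1$. Then $$\sum_{\substack{T:\,(w,T)\in\mathcal{A}^r(\Gamma^r(1,p))\\ wT(1)=b}}t^{N(w,T)}(1-t)^{|T|}=t^{N_{ab}(w[2,p+1])}(1-t)^{1-\delta_{ab}},$$ where $\delta_{ab}$ is the Kronecker delta.
   Context: Permutations in one-line notation; $(a,b)$, $a<b$, a transposition; $wT:=wt_1\cdots t_s$ for $T=(t_1,\dots,t_s)$ (right multiplication by $(a,b)$ swaps entries in positions $a,b$); Bruhat order as usual. $\Gamma^r(1,p)$ is the sequence $((1,p+2),(1,p+3),\dots,(1,n))$ (the reverse of $((1,n),(1,n-1),\dots,(1,2))$ with its first $p$ entries removed). $\mathcal{A}^r(\Gamma^r(1,p))$ is the set of pairs $(w,T)$ with $w\in S_n$ and $T=(t_1,\dots,t_s)$ a subsequence of $\Gamma^r(1,p)$ with $w<wt_1<\dots<wt_1\cdots t_s$ strictly in Bruhat order; $|T|=s$. For a sequence $u$, $u[i,j]=u(i)\cdots u(j)$ and $N_{cd}(u)$ is the number of entries $e$ with $c<e<d$. For a permutation $v$ and $S=((a_1,b_1),\dots,(a_q,b_q))$, $a_i<b_i$: $v_i=v(a_1,b_1)\cdots(a_i,b_i)$, $c_i=\min(v_i(a_i),v_i(b_i))$, $d_i=\max(v_i(a_i),v_i(b_i))$, $N(v,S)=\sum_{i=1}^qN_{c_id_i}(v_i[a_i,b_i])$. -}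

module Defs where

open import Data.Nat using (ℕ; zero; suc; _+_; _∸_; _<_; _≤_; _<ᵇ_; _≤ᵇ_)
open import Data.Bool using (Bool; true; false; _∧_; if_then_else_)
open import Data.Fin using (Fin; toℕ) renaming (zero to fzero)
open import Data.Fin.Properties using (_≟_)
open import Data.List using (List; []; _∷_; map; filterᵇ; length; allFin; foldr)
open import Data.Nat.ListAction using (sum)
open import Data.List.Relation.Binary.Sublist.Propositional using (_⊆_)
open import Data.Product using (Σ; _×_; _,_; ∃)
open import Data.Unit using (⊤)
open import Relation.Binary.PropositionalEquality using (_≡_)
open import Relation.Nullary using (does)
open import Data.Integer using (ℤ; _*_; _-_; _^_) renaming (+_ to ⁺_; _+_ to _+ℤ_)

-- Conventions: permutations of [n] are functions Fin n → Fin n in one-line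
-- notation, with positions AND values 0-indexed (paper's i ↦ Fin index i-1).

Transp : ℕ → Set
Transp n = Fin n × Fin n

swap : ∀ {n} → Fin n → Fin n → Fin n → Fin n
swap a b i = if does (i ≟ a) then b else (if does (i ≟ b) then a else i)

rmul : ∀ {n} → (Fin n → Fin n) → Transp n → (Fin n → Fin n)
rmul u (a , b) i = u (swap a b i)

applyT : ∀ {n} → (Fin n → Fin n) → List (Transp n) → (Fin n → Fin n)
applyT u [] = u
applyT u (t ∷ T) = applyT (rmul u t) T

inv : ∀ {n} → (Fin n → Fin n) → ℕ
inv {n} u = sum (map (λ i → length (filterᵇ (λ j → (toℕ i <ᵇ toℕ j) ∧ (toℕ (u j) <ᵇ toℕ (u i))) (allFin n))) (allFin n))

BStep : ∀ {n} → (Fin n → Fin n) → (Fin n → Fin n) → Set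
BStep {n} u v = Σ (Fin n) λ a → Σ (Fin n) λ b →
  (toℕ a < toℕ b) × ((∀ i → v i ≡ rmul u (a , b) i) × (inv u < inv v))

data _<B_ {n : ℕ} : (Fin n → Fin n) → (Fin n → Fin n) → Set where
  step  : ∀ {u v} → BStep u v → u <B v
  _then_ : ∀ {u v x} → u <B v → BStep v x → u <B x

Chain : ∀ {n} → (Fin n → Fin n) → List (Transp n) → Set
Chain u [] = ⊤
Chain u (t ∷ T) = (u <B rmul u t) × Chain (rmul u t) T

-- Γ^r(1,p) = ((1,p+2),(1,p+3),…,(1,n)) for n = suc m; 0-indexed:
-- ((0,p+1),(0,p+2),…,(0,m))
Γr : (m p : ℕ) → List (Transp (suc m))
Γr m p = map (λ j → (fzero , j)) (filterᵇ (λ j → suc p ≤ᵇ toℕ j) (allFin (suc m)))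

Nseg : ∀ {n} → (Fin n → Fin n) → (i j : ℕ) → (c d : ℕ) → ℕ
Nseg {n} u i j c d = length (filterᵇ
  (λ k → (i ≤ᵇ toℕ k) ∧ ((toℕ k ≤ᵇ j) ∧ ((c <ᵇ toℕ (u k)) ∧ (toℕ (u k) <ᵇ d))))
  (allFin n))

min' max' : ℕ → ℕ → ℕ
min' x y = if x ≤ᵇ y then x else y
max' x y = if x ≤ᵇ y then y else x

Nvs : ∀ {n} → (Fin n → Fin n) → List (Transp n) → ℕ
Nvs u [] = 0
Nvs u ((a , b) ∷ S) =
  let u' = rmul u (a , b)
      x  = toℕ (u' a)
      y  = toℕ (u' b)
  in Nseg u' (toℕ a) (toℕ b) (min' x y) (max' x y) + Nvs u' S

δ : ∀ {n} → Fin n → Fin n → ℕ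
δ a b = if does (a ≟ b) then 1 else 0

Adm : (m p : ℕ) → (Fin (suc m) → Fin (suc m)) → Fin (suc m) → List (Transp (suc m)) → Set
Adm m p w b T = (T ⊆ Γr m p) × (Chain w T × (applyT w T fzero ≡ b))

weight : ∀ {n} → ℤ → (Fin n → Fin n) → List (Transp n) → ℤ
weight t w T = (t ^ Nvs w T) * ((⁺ 1 - t) ^ length T)

sumℤ : List ℤ → ℤ
sumℤ = foldr _+ℤ_ (⁺ 0)

module Submission where

-- Proposition 5.3.  Positions and values are 0-indexed, so Γ^r(1,p) is the list of
-- transpositions (0,k), k = p+1, p+2, …, and the hypothesis p < w⁻¹(b) forces a = w(0) < b.
--
-- Exchanging the first entry with a larger entry strictly increases the number
--    of inversions, hence u < u(0,k) in the Bruhat order iff u(0) < u(k).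
--  * Enumeration.  `chains u ks` lists the admissible T along the positions ks: (0,k) is either
--    skipped, or taken when u(0) < u(k).  For the positions s+1, s+2, … the total weight is t^{N_{u(0),b}(u[1,s])}(1-t),
--    by induction with four cases for u(k): below u(0), equal to b, above b, between u(0) and b.
--  * The theorem is the case s = p.

open import Defs
open import Data.Bool using (Bool; true; false; T; T?; _∧_; if_then_else_)
open import Data.Bool.Properties using (T-∧; T-≡)
open import Data.Empty using (⊥-elim)
open import Data.Fin using (Fin; toℕ; suc) renaming (zero to fzero; _≤_ to _≤ᶠ_)
open import Data.Fin.Permutation using (Permutation′; _⟨$⟩ʳ_; _⟨$⟩ˡ_; inverseˡ; inverseʳ)
open import Data.Fin.Properties using (toℕ-injective) renaming (_≟_ to _≟ᶠ_)
open import Data.Integer using (ℤ; _*_; _-_; _^_) renaming (+_ to ⁺_; _+_ to _+ℤ_)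
import Data.Integer.Properties as ℤP
open import Data.Integer.Tactic.RingSolver using (solve-∀)
open import Data.List using (List; []; _∷_; map; filterᵇ; length; allFin; tabulate; _++_)
open import Data.List.Properties using (map-cong; map-++; map-∘; ∷-injectiveʳ; filter-all; filter-reject)
open import Data.List.Membership.Propositional using (_∈_)
open import Data.List.Membership.Propositional.Properties
  using (∈-allFin; ∈-map⁺; ∈-map⁻; ∈-++⁺ˡ; ∈-++⁺ʳ; ∈-++⁻; ∈-filter⁺)
open import Data.List.Membership.Propositional.Properties.WithK using (unique∧set⇒bag)
open import Data.List.Relation.Binary.BagAndSetEquality using (∼bag⇒↭)
open import Data.List.Relation.Binary.Permutation.Propositional using (↭⇒↭ₛ)
open import Data.List.Relation.Binary.Permutation.Propositional.Properties using (map⁺)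
open import Data.List.Relation.Binary.Permutation.Setoid.Properties using (foldr-commMonoid)
open import Data.List.Relation.Binary.Sublist.Propositional using (_⊆_; []; _∷_; _∷ʳ_)
import Data.List.Relation.Binary.Sublist.Propositional as Sublist
open import Data.List.Relation.Unary.All using (All; []; _∷_)
import Data.List.Relation.Unary.All as All
open import Data.List.Relation.Unary.AllPairs using ([]; _∷_)
open import Data.List.Relation.Unary.Any using (here; there)
open import Data.List.Relation.Unary.Unique.Propositional using (Unique)
open import Data.List.Relation.Unary.Unique.Propositional.Properties
  using (allFin⁺; ++⁺) renaming (map⁺ to unique-map⁺)
open import Data.Nat using (ℕ; zero; suc; _+_; _∸_; _<_; _≤_; _<ᵇ_; _≤ᵇ_; z≤n; s≤s)
open import Data.Nat.ListAction using (sum)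
open import Data.Nat.Properties
  using (≤-refl; ≤-reflexive; ≤-antisym; ≤-pred; <-irrefl; <-asym; <-trans; ≤-<-trans; <-≤-trans;
         <⇒≤; n≮0; <-cmp; _<?_; _≤?_; ≤∧≢⇒<; m≤n⇒m≤1+n; m≤n⇒m<n∨m≡n; ≤⇒≤ᵇ; ≤ᵇ⇒≤; <⇒<ᵇ; <ᵇ⇒<;
         +-mono-≤; +-mono-<-≤; +-mono-≤-<; +-assoc; +-comm; +-identityʳ; +-suc;
         +-commutativeSemigroup; module ≤-Reasoning)
open import Algebra.Properties.CommutativeSemigroup +-commutativeSemigroup using (interchange; x∙yz≈y∙xz)
open import Data.Product using (_×_; _,_; proj₁; proj₂; ∃)
open import Data.Sum using (inj₁; inj₂)
open import Data.Unit using (tt)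
open import Function.Base using (_∘_; id)
open import Function.Bundles using (Equivalence; _⇔_; mk⇔)
open import Function.Definitions using (Injective)
open import Relation.Binary.Definitions using (DecidableEquality; Tri; tri<; tri≈; tri>)
open import Relation.Binary.PropositionalEquality
open import Relation.Nullary using (¬_; Dec; does; yes; no)
open import Relation.Nullary.Decidable using (dec-true; dec-false)

ind : Bool → ℕ
ind true  = 1
ind false = 0

ind-mono : ∀ {a b} → (T a → T b) → ind a ≤ ind b
ind-mono {false}        _ = z≤n
ind-mono {true} {true}  _ = ≤-refl
ind-mono {true} {false} f = ⊥-elim (f tt)

ind-cong : ∀ {a b} → (T a → T b) → (T b → T a) → ind a ≡ ind b
ind-cong f g = ≤-antisym (ind-mono f) (ind-mono g)

ind-false : ∀ {a} → ¬ T a → ind a ≡ 0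
ind-false {false} _ = refl
ind-false {true}  f = ⊥-elim (f tt)

ind-true : ∀ {a} → T a → ind a ≡ 1
ind-true {true} _ = refl

count : {A : Set} → (A → Bool) → List A → ℕ
count P xs = length (filterᵇ P xs)

module _ {A : Set} where

  sum-map-+ : ∀ (f g : A → ℕ) xs →
    sum (map (λ x → f x + g x) xs) ≡ sum (map f xs) + sum (map g xs)
  sum-map-+ f g []       = refl
  sum-map-+ f g (x ∷ xs) =
    trans (cong (f x + g x +_) (sum-map-+ f g xs)) (interchange (f x) (g x) _ _)

  sum-mono : ∀ {f g : A → ℕ} xs → (∀ x → f x ≤ g x) → sum (map f xs) ≤ sum (map g xs)
  sum-mono []       f≤g = z≤n
  sum-mono (x ∷ xs) f≤g = +-mono-≤ (f≤g x) (sum-mono xs f≤g)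

  sum-< : ∀ {f g : A → ℕ} {a xs} → a ∈ xs → f a < g a → (∀ x → f x ≤ g x) →
    sum (map f xs) < sum (map g xs)
  sum-< {xs = x ∷ xs} (here refl) fa<ga f≤g = +-mono-<-≤ fa<ga (sum-mono xs f≤g)
  sum-< {xs = x ∷ xs} (there a∈)  fa<ga f≤g = +-mono-≤-< (f≤g x) (sum-< a∈ fa<ga f≤g)

  sum-zero : ∀ {f : A → ℕ} xs → (∀ x → f x ≡ 0) → sum (map f xs) ≡ 0
  sum-zero []       f≡0 = refl
  sum-zero (x ∷ xs) f≡0 = cong₂ _+_ (f≡0 x) (sum-zero xs f≡0)

  count-as-sum : ∀ (P : A → Bool) xs → count P xs ≡ sum (map (λ x → ind (P x)) xs)
  count-as-sum P []       = refl
  count-as-sum P (x ∷ xs) with P x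
  ... | true  = cong suc (count-as-sum P xs)
  ... | false = count-as-sum P xs

  count-mono : ∀ {P Q : A → Bool} xs → (∀ x → T (P x) → T (Q x)) → count P xs ≤ count Q xs
  count-mono {P} {Q} xs P⇒Q =
    subst₂ _≤_ (sym (count-as-sum P xs)) (sym (count-as-sum Q xs)) (sum-mono xs (λ x → ind-mono (P⇒Q x)))

  count-cong : ∀ {P Q : A → Bool} xs → (∀ x → P x ≡ Q x) → count P xs ≡ count Q xs
  count-cong xs P≡Q =
    ≤-antisym (count-mono xs (λ x → subst T (P≡Q x))) (count-mono xs (λ x → subst T (sym (P≡Q x))))

  count-+ : ∀ {P Q R : A → Bool} xs → (∀ x → ind (P x) ≡ ind (Q x) + ind (R x)) →
    count P xs ≡ count Q xs + count R xs
  count-+ {P} {Q} {R} xs split = begin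
    count P xs                                                         ≡⟨ count-as-sum P xs ⟩
    sum (map (λ x → ind (P x)) xs)                                     ≡⟨ cong sum (map-cong split xs) ⟩
    sum (map (λ x → ind (Q x) + ind (R x)) xs)                         ≡⟨ sum-map-+ _ _ xs ⟩
    sum (map (λ x → ind (Q x)) xs) + sum (map (λ x → ind (R x)) xs)    ≡⟨ cong₂ _+_ (count-as-sum Q xs) (count-as-sum R xs) ⟨
    count Q xs + count R xs                                            ∎
    where open ≡-Reasoning

  module _ (_≟_ : DecidableEquality A) where

    without : A → (A → ℕ) → A → ℕ
    without a f x = if does (x ≟ a) then 0 else f x

    without-≢ : ∀ {a x} (f : A → ℕ) → x ≢ a → without a f x ≡ f x
    without-≢ {a} {x} f x≢a with x ≟ a
    ... | yes x≡a = ⊥-elim (x≢a x≡a)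
    ... | no  _   = refl

    sum-without-∉ : ∀ {a} (f : A → ℕ) xs → All (a ≢_) xs → sum (map (without a f) xs) ≡ sum (map f xs)
    sum-without-∉ f []       []           = refl
    sum-without-∉ f (x ∷ xs) (a≢x ∷ a∉xs) =
      cong₂ _+_ (without-≢ f (λ x≡a → a≢x (sym x≡a))) (sum-without-∉ f xs a∉xs)

    sum-extract : ∀ {a xs} (f : A → ℕ) → Unique xs → a ∈ xs →
      sum (map f xs) ≡ f a + sum (map (without a f) xs)
    sum-extract {a} f (a∉xs ∷ _) (here refl) with a ≟ a
    ... | yes _   = cong (f a +_) (sym (sum-without-∉ f _ a∉xs))
    ... | no  a≢a = ⊥-elim (a≢a refl)
    sum-extract {a} {x ∷ xs} f (x∉xs ∷ uniq) (there a∈xs) = begin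
      f x + sum (map f xs)                                ≡⟨ cong (f x +_) (sum-extract f uniq a∈xs) ⟩
      f x + (f a + sum (map (without a f) xs))            ≡⟨ x∙yz≈y∙xz (f x) (f a) _ ⟩
      f a + (f x + sum (map (without a f) xs))            ≡⟨ cong (λ y → f a + (y + _)) (without-≢ f x≢a) ⟨
      f a + (without a f x + sum (map (without a f) xs))  ∎
      where
      open ≡-Reasoning
      x≢a : x ≢ a
      x≢a refl = All.lookup x∉xs a∈xs refl

    count-only : ∀ {P : A → Bool} {a xs} → Unique xs → a ∈ xs → (∀ x → T (P x) → x ≡ a) →
      count P xs ≡ ind (P a)
    count-only {P} {a} {xs} uniq a∈xs only-a = begin
      count P xs                                              ≡⟨ count-as-sum P xs ⟩
      sum (map (λ x → ind (P x)) xs)                          ≡⟨ sum-extract _ uniq a∈xs ⟩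
      ind (P a) + sum (map (without a (λ x → ind (P x))) xs)  ≡⟨ cong (ind (P a) +_) (sum-zero xs off-a) ⟩
      ind (P a) + 0                                           ≡⟨ +-identityʳ _ ⟩
      ind (P a)                                               ∎
      where
      open ≡-Reasoning
      off-a : ∀ x → without a (λ x → ind (P x)) x ≡ 0
      off-a x with x ≟ a
      ... | yes _   = refl
      ... | no  x≢a = ind-false (λ Px → x≢a (only-a x Px))

    sum-<-at-two : ∀ {f g : A → ℕ} {a b xs} → Unique xs → a ∈ xs → b ∈ xs → b ≢ a →
      (∀ x → x ≢ a → x ≢ b → f x ≤ g x) → f a + f b < g a + g b → sum (map f xs) < sum (map g xs)
    sum-<-at-two {f} {g} {a} {b} {xs} uniq a∈xs b∈xs b≢a others pair = begin-strict
      sum (map f xs)                     ≡⟨ two-points f ⟩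
      f a + f b + sum (map (rest f) xs)  <⟨ +-mono-<-≤ pair (sum-mono xs rest-mono) ⟩
      g a + g b + sum (map (rest g) xs)  ≡⟨ two-points g ⟨
      sum (map g xs)                     ∎
      where
      open ≤-Reasoning
      rest : (A → ℕ) → A → ℕ
      rest h = without b (without a h)

      two-points : ∀ h → sum (map h xs) ≡ h a + h b + sum (map (rest h) xs)
      two-points h = begin-equality
        sum (map h xs)                                  ≡⟨ sum-extract h uniq a∈xs ⟩
        h a + sum (map (without a h) xs)                ≡⟨ cong (h a +_) (sum-extract _ uniq b∈xs) ⟩
        h a + (without a h b + sum (map (rest h) xs))   ≡⟨ cong (λ y → h a + (y + sum (map (rest h) xs))) (without-≢ h b≢a) ⟩
        h a + (h b + sum (map (rest h) xs))             ≡⟨ +-assoc (h a) (h b) _ ⟨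
        h a + h b + sum (map (rest h) xs)               ∎

      rest-mono : ∀ x → rest f x ≤ rest g x
      rest-mono x with x ≟ b
      ... | yes _ = z≤n
      ... | no x≢b with x ≟ a
      ...   | yes _   = z≤n
      ...   | no  x≢a = others x x≢a x≢b

≤ᵇ-true : ∀ {m n} → m ≤ n → (m ≤ᵇ n) ≡ true
≤ᵇ-true m≤n = Equivalence.to T-≡ (≤⇒≤ᵇ m≤n)

≤ᵇ-false : ∀ {m n} → ¬ m ≤ n → (m ≤ᵇ n) ≡ false
≤ᵇ-false {m} {n} m≰n with m ≤ᵇ n in m≤ᵇn
... | true  = ⊥-elim (m≰n (≤ᵇ⇒≤ m n (Equivalence.from T-≡ m≤ᵇn)))
... | false = refl

≤ᵇ-step : ∀ {x j} → x ≢ suc j → (x ≤ᵇ suc j) ≡ (x ≤ᵇ j)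
≤ᵇ-step {x} {j} x≢1+j with x ≤? j
... | yes x≤j = trans (≤ᵇ-true (m≤n⇒m≤1+n x≤j)) (sym (≤ᵇ-true x≤j))
... | no  x≰j = trans (≤ᵇ-false x≰1+j) (sym (≤ᵇ-false x≰j))
  where
  x≰1+j : ¬ x ≤ suc j
  x≰1+j x≤1+j with m≤n⇒m<n∨m≡n x≤1+j
  ... | inj₁ x<1+j = x≰j (≤-pred x<1+j)
  ... | inj₂ x≡1+j = x≢1+j x≡1+j

between : ℕ → ℕ → ℕ → Bool
between c d y = (c <ᵇ y) ∧ (y <ᵇ d)

between-intro : ∀ {c d y} → c < y → y < d → T (between c d y)
between-intro c<y y<d = Equivalence.from T-∧ (<⇒<ᵇ c<y , <⇒<ᵇ y<d)

between-elim : ∀ c d {y} → T (between c d y) → c < y × y < d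
between-elim c d {y} c<y<d =
  let (c<y , y<d) = Equivalence.to T-∧ c<y<d in <ᵇ⇒< c y c<y , <ᵇ⇒< y d y<d

between-split : ∀ {c v d y} → c < v → v < d → y ≢ v →
  ind (between c d y) ≡ ind (between c v y) + ind (between v d y)
between-split {c} {v} {d} {y} c<v v<d y≢v with <-cmp y v
... | tri< y<v _ _ = begin
  ind (between c d y)                        ≡⟨ ind-cong (λ c<y<d → between-intro (proj₁ (between-elim c d c<y<d)) y<v)
                                                  (λ c<y<v → between-intro (proj₁ (between-elim c v c<y<v)) (<-trans y<v v<d)) ⟩
  ind (between c v y)                        ≡⟨ +-identityʳ _ ⟨
  ind (between c v y) + 0                    ≡⟨ cong (ind (between c v y) +_) (ind-false y∉vd) ⟨
  ind (between c v y) + ind (between v d y)  ∎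
  where
  open ≡-Reasoning
  y∉vd : ¬ T (between v d y)
  y∉vd v<y<d = <-asym y<v (proj₁ (between-elim v d v<y<d))
... | tri≈ _ y≡v _ = ⊥-elim (y≢v y≡v)
... | tri> _ _ v<y = trans
  (ind-cong (λ c<y<d → between-intro v<y (proj₂ (between-elim c d c<y<d)))
            (λ v<y<d → between-intro (<-trans c<v v<y) (proj₂ (between-elim v d v<y<d))))
  (cong (_+ ind (between v d y)) (sym (ind-false y∉cv)))
  where
  y∉cv : ¬ T (between c v y)
  y∉cv c<y<v = <-asym v<y (proj₂ (between-elim c v c<y<v))

-- Transpositions.  A sequence of entries of [n] in one-line notation (a permutation when
-- injective); right multiplication by (a,b) swaps the entries in positions a and b.

Seq : ℕ → Set
Seq n = Fin n → Fin n

swap-left : ∀ {n} (a b : Fin n) → swap a b a ≡ b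
swap-left a b with a ≟ᶠ a
... | yes _   = refl
... | no  a≢a = ⊥-elim (a≢a refl)

swap-right : ∀ {n} (a b : Fin n) → swap a b b ≡ a
swap-right a b with b ≟ᶠ a
... | yes b≡a = b≡a
... | no  _ with b ≟ᶠ b
...   | yes _   = refl
...   | no  b≢b = ⊥-elim (b≢b refl)

swap-other : ∀ {n} {a b i : Fin n} → i ≢ a → i ≢ b → swap a b i ≡ i
swap-other {a = a} {b} {i} i≢a i≢b with i ≟ᶠ a
... | yes i≡a = ⊥-elim (i≢a i≡a)
... | no  _ with i ≟ᶠ b
...   | yes i≡b = ⊥-elim (i≢b i≡b)
...   | no  _   = refl

swap-involutive : ∀ {n} (a b i : Fin n) → swap a b (swap a b i) ≡ i
swap-involutive a b i with i ≟ᶠ a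
... | yes refl = swap-right i b
... | no  i≢a with i ≟ᶠ b
...   | yes refl = swap-left a i
...   | no  i≢b  = swap-other i≢a i≢b

swap₀ : ∀ {m} → Seq (suc m) → Fin (suc m) → Seq (suc m)
swap₀ u k = rmul u (fzero , k)

module _ {m} (u : Seq (suc m)) (k : Fin (suc m)) where

  swap₀-at : swap₀ u k k ≡ u fzero
  swap₀-at = cong u (swap-right fzero k)

  swap₀-other : ∀ {i} → i ≢ fzero → i ≢ k → swap₀ u k i ≡ u i
  swap₀-other i≢0 i≢k = cong u (swap-other i≢0 i≢k)

  swap₀-involutive : ∀ i → swap₀ (swap₀ u k) k i ≡ u i
  swap₀-involutive i = cong u (swap-involutive fzero k i)

  swap₀-injective : Injective _≡_ _≡_ u → Injective _≡_ _≡_ (swap₀ u k)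
  swap₀-injective inj {i} {j} u′i≡u′j =
    trans (sym (swap-involutive fzero k i)) (trans (cong (swap fzero k) (inj u′i≡u′j)) (swap-involutive fzero k j))

nonzero-of-< : ∀ {m} {i j : Fin (suc m)} → toℕ i < toℕ j → j ≢ fzero
nonzero-of-< i<j refl = n≮0 i<j

positive-of-≢0 : ∀ {m} {j : Fin (suc m)} → j ≢ fzero → 0 < toℕ j
positive-of-≢0 {j = fzero}  j≢0 = ⊥-elim (j≢0 refl)
positive-of-≢0 {j = suc _}  _   = s≤s z≤n

inverted : ∀ {n} → Seq n → Fin n → Fin n → Bool
inverted u i j = (toℕ i <ᵇ toℕ j) ∧ (toℕ (u j) <ᵇ toℕ (u i))

inverted-intro : ∀ {n} (u : Seq n) {i j} → toℕ i < toℕ j → toℕ (u j) < toℕ (u i) → T (inverted u i j)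
inverted-intro u i<j uj<ui = Equivalence.from T-∧ (<⇒<ᵇ i<j , <⇒<ᵇ uj<ui)

inverted-elim : ∀ {n} (u : Seq n) {i j} → T (inverted u i j) → toℕ i < toℕ j × toℕ (u j) < toℕ (u i)
inverted-elim u {i} {j} inv-ij =
  let (i<j , uj<ui) = Equivalence.to T-∧ inv-ij
  in <ᵇ⇒< (toℕ i) (toℕ j) i<j , <ᵇ⇒< (toℕ (u j)) (toℕ (u i)) uj<ui

row : ∀ {n} → Seq n → Fin n → ℕ
row {n} u i = count (inverted u i) (allFin n)

inv-cong : ∀ {n} {u v : Seq n} → (∀ i → u i ≡ v i) → inv u ≡ inv v
inv-cong {n} u≗v = cong sum (map-cong (λ i → count-cong (allFin n) (λ j →
  cong₂ (λ x y → (toℕ i <ᵇ toℕ j) ∧ (toℕ x <ᵇ toℕ y)) (u≗v j) (u≗v i))) (allFin n))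

-- Exchanging the first entry with a larger entry at position k strictly increases inv: rows
-- other than 0 and k can only grow, and rows 0 and k together grow column by column, strictly
-- in column k because (0,k) becomes an inversion.
module IncreaseAtFront {m} (u : Seq (suc m)) (k : Fin (suc m)) (u0<uk : toℕ (u fzero) < toℕ (u k)) where

  private
    u′ = swap₀ u k

  k≢0 : k ≢ fzero
  k≢0 refl = <-irrefl refl u0<uk

  other-rows : ∀ i → i ≢ fzero → i ≢ k → row u i ≤ row u′ i
  other-rows i i≢0 i≢k = count-mono (allFin _) grows
    where
    grows : ∀ j → T (inverted u i j) → T (inverted u′ i j)
    grows j inv-ij = inverted-intro u′ i<j
      (subst (λ y → toℕ (u′ j) < toℕ y) (sym (swap₀-other u k i≢0 i≢k)) (u′j<ui (j ≟ᶠ k)))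
      where
      i<j = proj₁ (inverted-elim u inv-ij)
      uj<ui = proj₂ (inverted-elim u inv-ij)
      u′j<ui : Dec (j ≡ k) → toℕ (u′ j) < toℕ (u i)
      u′j<ui (yes j≡k) = subst (λ x → toℕ x < toℕ (u i)) (sym (trans (cong u′ j≡k) (swap₀-at u k)))
                           (<-trans (subst (λ x → toℕ (u fzero) < toℕ (u x)) (sym j≡k) u0<uk) uj<ui)
      u′j<ui (no j≢k)  = subst (λ x → toℕ x < toℕ (u i)) (sym (swap₀-other u k (nonzero-of-< i<j) j≢k)) uj<ui

  pair : Seq (suc m) → Fin (suc m) → ℕ
  pair v j = ind (inverted v fzero j) + ind (inverted v k j)

  pair-at-k : pair u k < pair u′ k
  pair-at-k = subst₂ _<_ (sym (cong₂ _+_ (ind-false old-0k) (ind-false old-kk)))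
                         (cong (_+ ind (inverted u′ k k)) (sym (ind-true new-0k)))
                         (s≤s z≤n)
    where
    old-0k : ¬ T (inverted u fzero k)
    old-0k inv-0k = <-asym u0<uk (proj₂ (inverted-elim u inv-0k))
    old-kk : ¬ T (inverted u k k)
    old-kk inv-kk = <-irrefl refl (proj₁ (inverted-elim u inv-kk))
    new-0k : T (inverted u′ fzero k)
    new-0k = inverted-intro u′ (positive-of-≢0 k≢0) (subst (λ x → toℕ x < toℕ (u k)) (sym (swap₀-at u k)) u0<uk)

  -- right of k the two rows exchange their roles; left of k only row 0 can have inversions
  pair-mono : ∀ j → pair u j ≤ pair u′ j
  pair-mono j = by-cases (j ≟ᶠ k) (j ≟ᶠ fzero) (toℕ k <? toℕ j)
    where
    u′j≡uj : j ≢ fzero → j ≢ k → u′ j ≡ u j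
    u′j≡uj = swap₀-other u k
    by-cases : Dec (j ≡ k) → Dec (j ≡ fzero) → Dec (toℕ k < toℕ j) → pair u j ≤ pair u′ j
    by-cases (yes refl) _          _         = <⇒≤ pair-at-k
    by-cases (no _)     (yes refl) _         = z≤n
    by-cases (no j≢k)   (no j≢0)   (yes k<j) =
      subst (pair u j ≤_) (+-comm (ind (inverted u′ k j)) _) (+-mono-≤ (ind-mono 0j⇒k′j) (ind-mono kj⇒0′j))
      where
      0j⇒k′j : T (inverted u fzero j) → T (inverted u′ k j)
      0j⇒k′j inv-0j = inverted-intro u′ k<j
        (subst₂ (λ x y → toℕ x < toℕ y) (sym (u′j≡uj j≢0 j≢k)) (sym (swap₀-at u k)) (proj₂ (inverted-elim u inv-0j)))
      kj⇒0′j : T (inverted u k j) → T (inverted u′ fzero j)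
      kj⇒0′j inv-kj = inverted-intro u′ (positive-of-≢0 j≢0)
        (subst (λ x → toℕ x < toℕ (u k)) (sym (u′j≡uj j≢0 j≢k)) (proj₂ (inverted-elim u inv-kj)))
    by-cases (no j≢k)   (no j≢0)   (no k≮j)  =
      +-mono-≤ (ind-mono 0j⇒0′j) (subst (_≤ ind (inverted u′ k j)) (sym (ind-false (k≮j ∘ proj₁ ∘ inverted-elim u))) z≤n)
      where
      0j⇒0′j : T (inverted u fzero j) → T (inverted u′ fzero j)
      0j⇒0′j inv-0j = inverted-intro u′ (positive-of-≢0 j≢0)
        (subst (λ x → toℕ x < toℕ (u k)) (sym (u′j≡uj j≢0 j≢k)) (<-trans (proj₂ (inverted-elim u inv-0j)) u0<uk))

  first-rows : row u fzero + row u k < row u′ fzero + row u′ k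
  first-rows = subst₂ _<_ (columns u) (columns u′) (sum-< (∈-allFin k) pair-at-k pair-mono)
    where
    columns : ∀ v → sum (map (pair v) (allFin _)) ≡ row v fzero + row v k
    columns v = trans (sum-map-+ (λ j → ind (inverted v fzero j)) (λ j → ind (inverted v k j)) (allFin (suc m)))
      (sym (cong₂ _+_ (count-as-sum (inverted v fzero) (allFin _)) (count-as-sum (inverted v k) (allFin _))))

  inv-swap₀-< : inv u < inv u′
  inv-swap₀-< = sum-<-at-two _≟ᶠ_ (allFin⁺ _) (∈-allFin fzero) (∈-allFin k) k≢0 other-rows first-rows

open IncreaseAtFront using (inv-swap₀-<)

inv-<B : ∀ {n} {u v : Seq n} → u <B v → inv u < inv v
inv-<B (step (_ , _ , _ , _ , inv<))     = inv<
inv-<B (u<v then (_ , _ , _ , _ , inv<)) = <-trans (inv-<B u<v) inv<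

<B-swap₀ : ∀ {m} (u : Seq (suc m)) k → toℕ (u fzero) < toℕ (u k) → u <B swap₀ u k
<B-swap₀ u k u0<uk =
  step (fzero , k , positive-of-≢0 (IncreaseAtFront.k≢0 u k u0<uk) , (λ _ → refl) , inv-swap₀-< u k u0<uk)

<B-swap₀⁻¹ : ∀ {m} (u : Seq (suc m)) k → u <B swap₀ u k → toℕ (u fzero) < toℕ (u k)
<B-swap₀⁻¹ u k u<u′ with <-cmp (toℕ (u fzero)) (toℕ (u k))
... | tri< u0<uk _ _ = u0<uk
... | tri≈ _ u0≡uk _ = ⊥-elim (<-irrefl (inv-cong unchanged) (inv-<B u<u′))
  where
  unchanged : ∀ i → u i ≡ swap₀ u k i
  unchanged i = by-cases (i ≟ᶠ fzero) (i ≟ᶠ k)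
    where
    by-cases : Dec (i ≡ fzero) → Dec (i ≡ k) → u i ≡ swap₀ u k i
    by-cases (yes refl) _          = toℕ-injective u0≡uk
    by-cases (no _)     (yes refl) = trans (sym (toℕ-injective u0≡uk)) (sym (swap₀-at u i))
    by-cases (no i≢0)   (no i≢k)   = sym (swap₀-other u k i≢0 i≢k)
... | tri> _ _ uk<u0 = ⊥-elim (<-asym (inv-<B u<u′) back)
  where
  -- exchanging back is again an increase, and returns to u
  back : inv (swap₀ u k) < inv u
  back = subst (inv (swap₀ u k) <_) (inv-cong (swap₀-involutive u k))
           (inv-swap₀-< (swap₀ u k) k (subst (λ x → toℕ (u k) < toℕ x) (sym (swap₀-at u k)) uk<u0))

Nseg-local : ∀ {n} {u v : Seq n} i j c d → (∀ x → i ≤ toℕ x → toℕ x ≤ j → u x ≡ v x) →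
  Nseg u i j c d ≡ Nseg v i j c d
Nseg-local {n} {u} {v} i j c d agree = count-cong (allFin n) same
  where
  same : ∀ x → (i ≤ᵇ toℕ x) ∧ ((toℕ x ≤ᵇ j) ∧ between c d (toℕ (u x)))
             ≡ (i ≤ᵇ toℕ x) ∧ ((toℕ x ≤ᵇ j) ∧ between c d (toℕ (v x)))
  same x with i ≤ᵇ toℕ x in i≤x | toℕ x ≤ᵇ j in x≤j
  ... | true  | true  = cong (between c d ∘ toℕ)
                          (agree x (≤ᵇ⇒≤ i _ (Equivalence.from T-≡ i≤x)) (≤ᵇ⇒≤ _ j (Equivalence.from T-≡ x≤j)))
  ... | true  | false = refl
  ... | false | _     = refl

Nseg-first : ∀ {m} (u : Seq (suc m)) j c d → Nseg u 0 j c d ≡ ind (between c d (toℕ (u fzero))) + Nseg u 1 j c d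
Nseg-first {m} u j c d =
  trans (count-+ {Q = at-first} {R = window 1} (allFin (suc m)) split)
        (cong (_+ Nseg u 1 j c d) (count-only _≟ᶠ_ (allFin⁺ _) (∈-allFin fzero) only-first))
  where
  window : ℕ → Fin (suc m) → Bool
  window i x = (i ≤ᵇ toℕ x) ∧ ((toℕ x ≤ᵇ j) ∧ between c d (toℕ (u x)))
  at-first : Fin (suc m) → Bool
  at-first fzero   = between c d (toℕ (u fzero))
  at-first (suc _) = false
  split : ∀ x → ind (window 0 x) ≡ ind (at-first x) + ind (window 1 x)
  split fzero   = sym (+-identityʳ _)
  split (suc _) = refl
  only-first : ∀ x → T (at-first x) → x ≡ fzero
  only-first fzero _ = refl

Nseg-last : ∀ {n} (u : Seq n) i j c d {k} → toℕ k ≡ suc j → i ≤ suc j →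
  Nseg u i (suc j) c d ≡ Nseg u i j c d + ind (between c d (toℕ (u k)))
Nseg-last {n} u i j c d {k} k≡1+j i≤1+j =
  trans (count-+ {Q = window j} {R = at-k} (allFin n) split) (cong (Nseg u i j c d +_) (begin
    count at-k (allFin n)                          ≡⟨ count-only _≟ᶠ_ (allFin⁺ n) (∈-allFin k) only-k ⟩
    ind (does (k ≟ᶠ k) ∧ between c d (toℕ (u k)))  ≡⟨ cong (λ e → ind (e ∧ between c d (toℕ (u k)))) (dec-true (k ≟ᶠ k) refl) ⟩
    ind (between c d (toℕ (u k)))                  ∎))
  where
  open ≡-Reasoning
  window : ℕ → Fin n → Bool
  window j′ x = (i ≤ᵇ toℕ x) ∧ ((toℕ x ≤ᵇ j′) ∧ between c d (toℕ (u x)))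
  at-k : Fin n → Bool
  at-k x = does (x ≟ᶠ k) ∧ between c d (toℕ (u x))
  -- j+1 ≤ᵇ j computes to j <ᵇ j
  j≮ᵇj : (j <ᵇ j) ≡ false
  j≮ᵇj = ≤ᵇ-false {suc j} {j} (<-irrefl refl)
  split : ∀ x → ind (window (suc j) x) ≡ ind (window j x) + ind (at-k x)
  split x with x ≟ᶠ k
  ... | yes refl rewrite k≡1+j | ≤ᵇ-true i≤1+j | ≤ᵇ-true (≤-refl {suc j}) | j≮ᵇj = refl
  ... | no  x≢k  rewrite ≤ᵇ-step {toℕ x} {j} (λ x≡1+j → x≢k (toℕ-injective (trans x≡1+j (sym k≡1+j)))) =
    sym (+-identityʳ _)
  only-k : ∀ x → T (at-k x) → x ≡ k
  only-k x _ with x ≟ᶠ k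
  ... | yes x≡k = x≡k

Nseg-split : ∀ {n} (u : Seq n) i j {c v d} → c < v → v < d → (∀ x → i ≤ toℕ x → toℕ x ≤ j → toℕ (u x) ≢ v) →
  Nseg u i j c v + Nseg u i j v d ≡ Nseg u i j c d
Nseg-split {n} u i j {c} {v} {d} c<v v<d avoids = sym (count-+ {Q = window c v} {R = window v d} (allFin n) split)
  where
  window : ℕ → ℕ → Fin n → Bool
  window c′ d′ x = (i ≤ᵇ toℕ x) ∧ ((toℕ x ≤ᵇ j) ∧ between c′ d′ (toℕ (u x)))
  split : ∀ x → ind (window c d x) ≡ ind (window c v x) + ind (window v d x)
  split x with i ≤ᵇ toℕ x in i≤x | toℕ x ≤ᵇ j in x≤j
  ... | true  | true  = between-split c<v v<d
                          (avoids x (≤ᵇ⇒≤ i _ (Equivalence.from T-≡ i≤x)) (≤ᵇ⇒≤ _ j (Equivalence.from T-≡ x≤j)))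
  ... | true  | false = refl
  ... | false | _     = refl

-- the first summand N_{c₁d₁}(v₁[a₁,b₁]) of N(u,T) for T starting with (0,k)
stepN : ∀ {m} → Seq (suc m) → Fin (suc m) → ℕ
stepN u k = Nseg (swap₀ u k) 0 (toℕ k) (min' (toℕ (u k)) (toℕ (swap₀ u k k))) (max' (toℕ (u k)) (toℕ (swap₀ u k k)))

module AdjacentWindow {m} (u : Seq (suc m)) {k : Fin (suc m)} {s : ℕ} (k≡1+s : toℕ k ≡ suc s) where

  swap₀-window : ∀ c d → ¬ T (between c d (toℕ (u fzero))) → Nseg (swap₀ u k) 1 (suc s) c d ≡ Nseg u 1 s c d
  swap₀-window c d u0∉ = begin
    Nseg u′ 1 (suc s) c d                                ≡⟨ Nseg-last u′ 1 s c d k≡1+s (s≤s z≤n) ⟩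
    Nseg u′ 1 s c d + ind (between c d (toℕ (u′ k)))     ≡⟨ cong (λ x → Nseg u′ 1 s c d + ind (between c d (toℕ x))) (swap₀-at u k) ⟩
    Nseg u′ 1 s c d + ind (between c d (toℕ (u fzero)))  ≡⟨ cong (Nseg u′ 1 s c d +_) (ind-false u0∉) ⟩
    Nseg u′ 1 s c d + 0                                  ≡⟨ +-identityʳ _ ⟩
    Nseg u′ 1 s c d                                      ≡⟨ Nseg-local 1 s c d unchanged ⟩
    Nseg u 1 s c d                                       ∎
    where
    open ≡-Reasoning
    u′ = swap₀ u k
    unchanged : ∀ x → 1 ≤ toℕ x → toℕ x ≤ s → u′ x ≡ u x
    unchanged x 1≤x x≤s = swap₀-other u k (nonzero-of-< {i = fzero} 1≤x)
      (λ x≡k → <-irrefl refl (subst (_≤ s) (trans (cong toℕ x≡k) k≡1+s) x≤s))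

  step-exponent : toℕ (u fzero) < toℕ (u k) → stepN u k ≡ Nseg u 1 s (toℕ (u fzero)) (toℕ (u k))
  step-exponent u0<uk = begin
    stepN u k                                    ≡⟨ cong (λ x → Nseg u′ 0 (toℕ k) (min' v (toℕ x)) (max' v (toℕ x))) (swap₀-at u k) ⟩
    Nseg u′ 0 (toℕ k) (min' v c) (max' v c)      ≡⟨ cong₂ (Nseg u′ 0 (toℕ k)) min≡c max≡v ⟩
    Nseg u′ 0 (toℕ k) c v                        ≡⟨ cong (λ j → Nseg u′ 0 j c v) k≡1+s ⟩
    Nseg u′ 0 (suc s) c v                        ≡⟨ Nseg-first u′ (suc s) c v ⟩
    ind (between c v v) + Nseg u′ 1 (suc s) c v  ≡⟨ cong (_+ Nseg u′ 1 (suc s) c v) (ind-false (<-irrefl refl ∘ proj₂ ∘ between-elim c v)) ⟩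
    Nseg u′ 1 (suc s) c v                        ≡⟨ swap₀-window c v (<-irrefl refl ∘ proj₁ ∘ between-elim c v) ⟩
    Nseg u 1 s c v                               ∎
    where
    open ≡-Reasoning
    u′ = swap₀ u k
    c = toℕ (u fzero)
    v = toℕ (u k)
    v≰c : ¬ v ≤ c
    v≰c v≤c = <-irrefl refl (<-≤-trans u0<uk v≤c)
    min≡c : min' v c ≡ c
    min≡c rewrite ≤ᵇ-false v≰c = refl
    max≡v : max' v c ≡ v
    max≡v rewrite ≤ᵇ-false v≰c = refl

data Consecutive {n : ℕ} : ℕ → List (Fin n) → Set where
  []  : ∀ {s} → Consecutive s []
  _∷_ : ∀ {s k ks} → toℕ k ≡ s → Consecutive (suc s) ks → Consecutive s (k ∷ ks)

consecutive-≥ : ∀ {n s} {ks : List (Fin n)} → Consecutive s ks → All (λ j → s ≤ toℕ j) ks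
consecutive-≥ []          = []
consecutive-≥ (k≡s ∷ run) = ≤-reflexive (sym k≡s) ∷ All.map <⇒≤ (consecutive-≥ run)

consecutive-unique : ∀ {n s} {ks : List (Fin n)} → Consecutive s ks → Unique ks
consecutive-unique []          = []
consecutive-unique (k≡s ∷ run) =
  All.map (λ s<j k≡j → <-irrefl (trans (sym k≡s) (cong toℕ k≡j)) s<j) (consecutive-≥ run) ∷ consecutive-unique run

consecutive-nonzero : ∀ {m s} {ks : List (Fin (suc m))} → Consecutive (suc s) ks → All (_≢ fzero) ks
consecutive-nonzero run = All.map (λ s<j → nonzero-of-< {i = fzero} (≤-<-trans z≤n s<j)) (consecutive-≥ run)

consecutive-tabulate : ∀ {n N r} (f : Fin n → Fin N) → (∀ i → toℕ (f i) ≡ r + toℕ i) → Consecutive r (tabulate f)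
consecutive-tabulate {zero}          f shift = []
consecutive-tabulate {suc n} {r = r} f shift =
  trans (shift fzero) (+-identityʳ r) ∷ consecutive-tabulate (f ∘ suc) (λ i → trans (shift (suc i)) (+-suc r (toℕ i)))

consecutive-filter : ∀ {n r s} {ks : List (Fin n)} → Consecutive r ks → r ≤ s →
  Consecutive s (filterᵇ (λ j → s ≤ᵇ toℕ j) ks)
consecutive-filter [] r≤s = []
consecutive-filter {r = r} {s} (_∷_ {k = k} k≡r run) r≤s with m≤n⇒m<n∨m≡n r≤s
... | inj₁ r<s = subst (Consecutive s) (sym (filter-reject (λ j → T? (s ≤ᵇ toℕ j)) k≱s)) (consecutive-filter run r<s)
  where
  k≱s : ¬ T (s ≤ᵇ toℕ k)
  k≱s s≤k = <-irrefl refl (≤-<-trans (≤ᵇ⇒≤ s _ s≤k) (subst (_< s) (sym k≡r) r<s))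
... | inj₂ refl =
  subst (Consecutive s) (sym (filter-all (λ j → T? (s ≤ᵇ toℕ j)) (All.map ≤⇒≤ᵇ (consecutive-≥ (k≡r ∷ run)))))
    (k≡r ∷ run)

module Enumeration {m : ℕ} (b : Fin (suc m)) where

  τ : Fin (suc m) → Transp (suc m)
  τ k = (fzero , k)

  Admissible : Seq (suc m) → List (Fin (suc m)) → List (Transp (suc m)) → Set
  Admissible u ks T = (T ⊆ map τ ks) × (Chain u T × (applyT u T fzero ≡ b))

  chains : Seq (suc m) → List (Fin (suc m)) → List (List (Transp (suc m)))
  chains u [] with u fzero ≟ᶠ b
  ... | yes _ = [] ∷ []
  ... | no  _ = []
  chains u (k ∷ ks) with toℕ (u fzero) <? toℕ (u k)
  ... | yes _ = map (τ k ∷_) (chains (swap₀ u k) ks) ++ chains u ks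
  ... | no  _ = chains u ks

  admissible-skip : ∀ {u k ks T} → Admissible u ks T → Admissible u (k ∷ ks) T
  admissible-skip {k = k} (T⊆ , chain , front) = τ k ∷ʳ T⊆ , chain , front

  chains-sound : ∀ u ks {T} → T ∈ chains u ks → Admissible u ks T
  chains-sound u [] T∈ with u fzero ≟ᶠ b
  chains-sound u [] (here refl) | yes u0≡b = [] , _ , u0≡b
  chains-sound u (k ∷ ks) T∈ with toℕ (u fzero) <? toℕ (u k)
  ... | no  _ = admissible-skip (chains-sound u ks T∈)
  ... | yes u0<uk with ∈-++⁻ (map (τ k ∷_) (chains (swap₀ u k) ks)) T∈
  ...   | inj₂ T∈skipping = admissible-skip (chains-sound u ks T∈skipping)
  ...   | inj₁ T∈using with ∈-map⁻ (τ k ∷_) T∈using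
  ...     | T′ , T′∈ , refl =
    let (T′⊆ , chain , front) = chains-sound (swap₀ u k) ks T′∈
    in refl ∷ T′⊆ , (<B-swap₀ u k u0<uk , chain) , front

  chains-complete : ∀ u ks {T} → Admissible u ks T → T ∈ chains u ks
  chains-complete u [] ([] , _ , u0≡b) with u fzero ≟ᶠ b
  ... | yes _    = here refl
  ... | no  u0≢b = ⊥-elim (u0≢b u0≡b)
  chains-complete u (k ∷ ks) (_ ∷ʳ T⊆ , chain , front) with toℕ (u fzero) <? toℕ (u k)
  ... | yes _ = ∈-++⁺ʳ (map (τ k ∷_) (chains (swap₀ u k) ks)) (chains-complete u ks (T⊆ , chain , front))
  ... | no  _ = chains-complete u ks (T⊆ , chain , front)
  chains-complete u (k ∷ ks) (refl ∷ T′⊆ , (u<u′ , chain) , front) with toℕ (u fzero) <? toℕ (u k)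
  ... | yes _     = ∈-++⁺ˡ (∈-map⁺ (τ k ∷_) (chains-complete (swap₀ u k) ks (T′⊆ , chain , front)))
  ... | no  u0≮uk = ⊥-elim (u0≮uk (<B-swap₀⁻¹ u k u<u′))

  -- for distinct positions, the chains using (0,k) do not occur among those skipping it
  chains-unique : ∀ u {ks} → Unique ks → Unique (chains u ks)
  chains-unique u {[]} [] with u fzero ≟ᶠ b
  ... | yes _ = [] ∷ []
  ... | no  _ = []
  chains-unique u {k ∷ ks} (k∉ks ∷ uks) with toℕ (u fzero) <? toℕ (u k)
  ... | no  _ = chains-unique u uks
  ... | yes _ = ++⁺ (unique-map⁺ ∷-injectiveʳ (chains-unique (swap₀ u k) uks)) (chains-unique u uks) disjoint
    where
    disjoint : ∀ {T} → ¬ (T ∈ map (τ k ∷_) (chains (swap₀ u k) ks) × T ∈ chains u ks)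
    disjoint (T∈using , T∈skipping) with ∈-map⁻ (τ k ∷_) T∈using
    ... | _ , _ , refl with ∈-map⁻ τ (Sublist.lookup (proj₁ (chains-sound u ks T∈skipping)) (here refl))
    ...   | j , j∈ks , refl = All.lookup k∉ks j∈ks refl

  -- once the first entry exceeds b it only grows along a chain, so b is never brought to the front
  chains-above : ∀ u ks → toℕ b < toℕ (u fzero) → chains u ks ≡ []
  chains-above u [] b<u0 with u fzero ≟ᶠ b
  ... | yes u0≡b = ⊥-elim (<-irrefl (cong toℕ (sym u0≡b)) b<u0)
  ... | no  _    = refl
  chains-above u (k ∷ ks) b<u0 with toℕ (u fzero) <? toℕ (u k)
  ... | yes u0<uk rewrite chains-above (swap₀ u k) ks (<-trans b<u0 u0<uk) = chains-above u ks b<u0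
  ... | no  _     = chains-above u ks b<u0

  chains-at : ∀ u ks → u fzero ≡ b → chains u ks ≡ [] ∷ []
  chains-at u [] u0≡b with u fzero ≟ᶠ b
  ... | yes _    = refl
  ... | no  u0≢b = ⊥-elim (u0≢b u0≡b)
  chains-at u (k ∷ ks) u0≡b with toℕ (u fzero) <? toℕ (u k)
  ... | yes u0<uk rewrite chains-above (swap₀ u k) ks (subst (λ x → toℕ x < toℕ (u k)) u0≡b u0<uk) =
    chains-at u ks u0≡b
  ... | no  _ = chains-at u ks u0≡b

  chains-unreachable : ∀ u {ks} → Unique ks → All (_≢ fzero) ks → u fzero ≢ b → (∀ {j} → j ∈ ks → u j ≢ b) →
    chains u ks ≡ []
  chains-unreachable u {[]} _ _ u0≢b _ with u fzero ≟ᶠ b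
  ... | yes u0≡b = ⊥-elim (u0≢b u0≡b)
  ... | no  _    = refl
  chains-unreachable u {k ∷ ks} (k∉ks ∷ uks) (_ ∷ nonzero) u0≢b absent with toℕ (u fzero) <? toℕ (u k)
  ... | yes _ = cong₂ (λ used skipped → map (τ k ∷_) used ++ skipped)
                  (chains-unreachable (swap₀ u k) uks nonzero (absent (here refl)) absent′)
                  (chains-unreachable u uks nonzero u0≢b (absent ∘ there))
    where
    absent′ : ∀ {j} → j ∈ ks → swap₀ u k j ≢ b
    absent′ j∈ = subst (_≢ b) (sym (swap₀-other u k (All.lookup nonzero j∈) (λ j≡k → All.lookup k∉ks j∈ (sym j≡k))))
                   (absent (there j∈))
  ... | no  _ = chains-unreachable u uks nonzero u0≢b (absent ∘ there)

sumℤ-++ : ∀ xs ys → sumℤ (xs ++ ys) ≡ sumℤ xs +ℤ sumℤ ys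
sumℤ-++ []       ys = sym (ℤP.+-identityˡ _)
sumℤ-++ (x ∷ xs) ys = trans (cong (x +ℤ_) (sumℤ-++ xs ys)) (sym (ℤP.+-assoc x _ _))

sumℤ-scale : ∀ {A : Set} c (f : A → ℤ) xs → sumℤ (map (λ x → c * f x) xs) ≡ c * sumℤ (map f xs)
sumℤ-scale c f []       = sym (ℤP.*-zeroʳ c)
sumℤ-scale c f (x ∷ xs) = trans (cong (c * f x +ℤ_) (sumℤ-scale c f xs)) (sym (ℤP.*-distribˡ-+ c (f x) _))

sumℤ-same-members : ∀ {A : Set} (f : A → ℤ) {xs ys : List A} → Unique xs → Unique ys →
  (∀ {x} → x ∈ xs ⇔ x ∈ ys) → sumℤ (map f xs) ≡ sumℤ (map f ys)
sumℤ-same-members f uxs uys same =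
  foldr-commMonoid (setoid ℤ) ℤP.+-0-isCommutativeMonoid (↭⇒↭ₛ (map⁺ f (∼bag⇒↭ (unique∧set⇒bag uxs uys same))))

two-routes : ∀ t Z Y →
  t ^ Z * ((⁺ 1 - t) * (t ^ Y * (⁺ 1 - t))) +ℤ t ^ (Z + Y + 1) * (⁺ 1 - t) ≡ t ^ (Z + Y) * (⁺ 1 - t)
two-routes t Z Y rewrite ℤP.^-distribˡ-+-* t (Z + Y) 1 | ℤP.^-distribˡ-+-* t Z Y = identity (t ^ Z) (t ^ Y) t
  where
  identity : ∀ a b t → a * ((⁺ 1 - t) * (b * (⁺ 1 - t))) +ℤ a * b * (t * ⁺ 1) * (⁺ 1 - t) ≡ a * b * (⁺ 1 - t)
  identity = solve-∀

module TotalWeight {m : ℕ} (b : Fin (suc m)) (t : ℤ) where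
  open Enumeration b

  q : ℤ
  q = ⁺ 1 - t

  total : Seq (suc m) → List (Fin (suc m)) → ℤ
  total u ks = sumℤ (map (weight t u) (chains u ks))

  weight-step : ∀ u k T → weight t u (τ k ∷ T) ≡ t ^ stepN u k * (q * weight t (swap₀ u k) T)
  weight-step u k T = begin
    t ^ (stepN u k + Nvs u′ T) * (q * q ^ length T)
      ≡⟨ cong (_* (q * q ^ length T)) (ℤP.^-distribˡ-+-* t (stepN u k) (Nvs u′ T)) ⟩
    t ^ stepN u k * t ^ Nvs u′ T * (q * q ^ length T)
      ≡⟨ reassociate (t ^ stepN u k) (t ^ Nvs u′ T) q (q ^ length T) ⟩
    t ^ stepN u k * (q * (t ^ Nvs u′ T * q ^ length T))
      ∎
    where
    open ≡-Reasoning
    u′ = swap₀ u k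
    reassociate : ∀ a b q c → a * b * (q * c) ≡ a * (q * (b * c))
    reassociate = solve-∀

  total-skip : ∀ {u k ks} → ¬ toℕ (u fzero) < toℕ (u k) → total u (k ∷ ks) ≡ total u ks
  total-skip {u} {k} u0≮uk with toℕ (u fzero) <? toℕ (u k)
  ... | yes u0<uk = ⊥-elim (u0≮uk u0<uk)
  ... | no  _     = refl

  total-use : ∀ {u k ks} → toℕ (u fzero) < toℕ (u k) →
    total u (k ∷ ks) ≡ t ^ stepN u k * (q * total (swap₀ u k) ks) +ℤ total u ks
  total-use {u} {k} {ks} u0<uk with toℕ (u fzero) <? toℕ (u k)
  ... | no  u0≮uk = ⊥-elim (u0≮uk u0<uk)
  ... | yes _     = begin
    sumℤ (map (weight t u) (map (τ k ∷_) used ++ chains u ks))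
      ≡⟨ cong sumℤ (map-++ (weight t u) (map (τ k ∷_) used) _) ⟩
    sumℤ (map (weight t u) (map (τ k ∷_) used) ++ map (weight t u) (chains u ks))
      ≡⟨ sumℤ-++ (map (weight t u) (map (τ k ∷_) used)) _ ⟩
    sumℤ (map (weight t u) (map (τ k ∷_) used)) +ℤ total u ks
      ≡⟨ cong (λ xs → sumℤ xs +ℤ total u ks) (sym (map-∘ used)) ⟩
    sumℤ (map (λ T → weight t u (τ k ∷ T)) used) +ℤ total u ks
      ≡⟨ cong (λ xs → sumℤ xs +ℤ total u ks) (map-cong (weight-step u k) used) ⟩
    sumℤ (map (λ T → t ^ stepN u k * (q * weight t u′ T)) used) +ℤ total u ks
      ≡⟨ cong (_+ℤ total u ks) (sumℤ-scale (t ^ stepN u k) _ used) ⟩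
    t ^ stepN u k * sumℤ (map (λ T → q * weight t u′ T) used) +ℤ total u ks
      ≡⟨ cong (λ x → t ^ stepN u k * x +ℤ total u ks) (sumℤ-scale q (weight t u′) used) ⟩
    t ^ stepN u k * (q * total u′ ks) +ℤ total u ks
      ∎
    where
    open ≡-Reasoning
    u′ = swap₀ u k
    used = chains u′ ks

  Formula : ℕ → List (Fin (suc m)) → Set
  Formula s ks = ∀ u → Injective _≡_ _≡_ u → toℕ (u fzero) < toℕ b → (∃ λ k* → k* ∈ ks × u k* ≡ b) →
    total u ks ≡ t ^ Nseg u 1 s (toℕ (u fzero)) (toℕ b) * q

  module Step {s k ks} (k≡1+s : toℕ k ≡ suc s) (run : Consecutive (suc (suc s)) ks) (IH : Formula (suc s) ks)
              (u : Seq (suc m)) (inj : Injective _≡_ _≡_ u) (u0<b : toℕ (u fzero) < toℕ b)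
              {k* : Fin (suc m)} (k*∈ : k* ∈ k ∷ ks) (uk*≡b : u k* ≡ b) where
    open AdjacentWindow u k≡1+s
    open ≡-Reasoning

    u′ = swap₀ u k
    c = toℕ (u fzero)
    v = toℕ (u k)
    B = toℕ b
    X = Nseg u 1 s c B

    fresh : ∀ {j} → j ∈ ks → j ≢ k
    fresh j∈ refl = <-irrefl (sym k≡1+s) (All.lookup (consecutive-≥ run) j∈)

    b-later : u k ≢ b → k* ∈ ks
    b-later uk≢b = elsewhere k*∈
      where
      elsewhere : k* ∈ k ∷ ks → k* ∈ ks
      elsewhere (here refl)  = ⊥-elim (uk≢b uk*≡b)
      elsewhere (there k*∈′) = k*∈′

    skipping : u k ≢ b → total u ks ≡ t ^ Nseg u 1 (suc s) c B * q
    skipping uk≢b = IH u inj u0<b (k* , b-later uk≢b , uk*≡b)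

    grow : ¬ T (between c B v) → Nseg u 1 (suc s) c B ≡ X
    grow uk∉ = trans (Nseg-last u 1 s c B k≡1+s (s≤s z≤n)) (trans (cong (X +_) (ind-false uk∉)) (+-identityʳ X))

    -- (0,k) is no Bruhat step
    below-u0 : ¬ c < v → total u (k ∷ ks) ≡ t ^ X * q
    below-u0 u0≮uk = begin
      total u (k ∷ ks)              ≡⟨ total-skip {u} {k} {ks} u0≮uk ⟩
      total u ks                    ≡⟨ skipping (λ uk≡b → u0≮uk (subst (λ x → c < toℕ x) (sym uk≡b) u0<b)) ⟩
      t ^ Nseg u 1 (suc s) c B * q  ≡⟨ cong (λ e → t ^ e * q) (grow (u0≮uk ∘ proj₁ ∘ between-elim c B)) ⟩
      t ^ X * q                     ∎

    -- u k = b: using (0,k) brings b to the front, and skipping it b is never reached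
    at-b : c < v → v ≡ B → total u (k ∷ ks) ≡ t ^ X * q
    at-b u0<uk v≡B = begin
      total u (k ∷ ks)                                  ≡⟨ total-use {u} {k} {ks} u0<uk ⟩
      t ^ stepN u k * (q * total u′ ks) +ℤ total u ks   ≡⟨ cong₂ (λ e r → t ^ e * (q * total u′ ks) +ℤ r) exponent none-skipping ⟩
      t ^ X * (q * total u′ ks) +ℤ ⁺ 0                  ≡⟨ ℤP.+-identityʳ _ ⟩
      t ^ X * (q * total u′ ks)                         ≡⟨ cong (λ r → t ^ X * (q * r)) only-empty ⟩
      t ^ X * (q * ⁺ 1)                                 ≡⟨ cong (t ^ X *_) (ℤP.*-identityʳ q) ⟩
      t ^ X * q                                         ∎
      where
      uk≡b : u k ≡ b
      uk≡b = toℕ-injective v≡B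
      exponent : stepN u k ≡ X
      exponent = trans (step-exponent u0<uk) (cong (Nseg u 1 s c) v≡B)
      only-empty : total u′ ks ≡ ⁺ 1
      only-empty = cong (λ Ts → sumℤ (map (weight t u′) Ts)) (chains-at u′ ks uk≡b)
      none-skipping : total u ks ≡ ⁺ 0
      none-skipping = cong (λ Ts → sumℤ (map (weight t u) Ts))
        (chains-unreachable u (consecutive-unique run) (consecutive-nonzero run) (λ u0≡b → <-irrefl (cong toℕ u0≡b) u0<b)
          (λ j∈ uj≡b → fresh j∈ (inj (trans uj≡b (sym uk≡b)))))

    -- b < u k: after (0,k) the first entry is already beyond b
    above-b : c < v → B < v → total u (k ∷ ks) ≡ t ^ X * q
    above-b u0<uk B<v = begin
      total u (k ∷ ks)                                  ≡⟨ total-use {u} {k} {ks} u0<uk ⟩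
      t ^ stepN u k * (q * total u′ ks) +ℤ total u ks   ≡⟨ cong (λ r → t ^ stepN u k * (q * r) +ℤ total u ks) none-using ⟩
      t ^ stepN u k * (q * ⁺ 0) +ℤ total u ks           ≡⟨ cong (_+ℤ total u ks) (trans (cong (t ^ stepN u k *_) (ℤP.*-zeroʳ q)) (ℤP.*-zeroʳ (t ^ stepN u k))) ⟩
      ⁺ 0 +ℤ total u ks                                 ≡⟨ ℤP.+-identityˡ _ ⟩
      total u ks                                        ≡⟨ skipping (λ uk≡b → <-irrefl (sym (cong toℕ uk≡b)) B<v) ⟩
      t ^ Nseg u 1 (suc s) c B * q                      ≡⟨ cong (λ e → t ^ e * q) (grow (<-asym B<v ∘ proj₂ ∘ between-elim c B)) ⟩
      t ^ X * q                                         ∎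
      where
      none-using : total u′ ks ≡ ⁺ 0
      none-using = cong (λ Ts → sumℤ (map (weight t u′) Ts)) (chains-above u′ ks B<v)

    -- u 0 < u k < b: using and skipping (0,k) both contribute, splitting (u 0, b) at u k
    between-u0-b : c < v → v < B → total u (k ∷ ks) ≡ t ^ X * q
    between-u0-b u0<uk v<B = begin
      total u (k ∷ ks)                                  ≡⟨ total-use {u} {k} {ks} u0<uk ⟩
      t ^ stepN u k * (q * total u′ ks) +ℤ total u ks   ≡⟨ cong₂ (λ e r → t ^ e * (q * r) +ℤ total u ks) (step-exponent u0<uk) taken ⟩
      t ^ Z * (q * (t ^ Y * q)) +ℤ total u ks           ≡⟨ cong (t ^ Z * (q * (t ^ Y * q)) +ℤ_) skipped ⟩
      t ^ Z * (q * (t ^ Y * q)) +ℤ t ^ (Z + Y + 1) * q  ≡⟨ two-routes t Z Y ⟩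
      t ^ (Z + Y) * q                                   ≡⟨ cong (λ e → t ^ e * q) split ⟩
      t ^ X * q                                         ∎
      where
      Z = Nseg u 1 s c v
      Y = Nseg u 1 s v B
      uk≢b : u k ≢ b
      uk≢b uk≡b = <-irrefl (cong toℕ uk≡b) v<B
      split : Z + Y ≡ X
      split = Nseg-split u 1 s u0<uk v<B λ x _ x≤s ux≡uk →
        <-irrefl refl (subst (_≤ s) (trans (cong toℕ (inj (toℕ-injective ux≡uk))) k≡1+s) x≤s)
      taken : total u′ ks ≡ t ^ Y * q
      taken = trans (IH u′ (swap₀-injective u k inj) v<B (k* , k*∈ks , trans (swap₀-other u k k*≢0 (fresh k*∈ks)) uk*≡b))
                    (cong (λ e → t ^ e * q) (swap₀-window v B (<-asym u0<uk ∘ proj₁ ∘ between-elim v B)))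
        where
        k*∈ks = b-later uk≢b
        k*≢0 = All.lookup (consecutive-nonzero run) k*∈ks
      skipped : total u ks ≡ t ^ (Z + Y + 1) * q
      skipped = trans (skipping uk≢b) (cong (λ e → t ^ e * q) (begin
        Nseg u 1 (suc s) c B     ≡⟨ Nseg-last u 1 s c B k≡1+s (s≤s z≤n) ⟩
        X + ind (between c B v)  ≡⟨ cong₂ _+_ (sym split) (ind-true (between-intro u0<uk v<B)) ⟩
        Z + Y + 1                ∎))

  formula-step : ∀ {s k ks} → toℕ k ≡ suc s → Consecutive (suc (suc s)) ks → Formula (suc s) ks → Formula s (k ∷ ks)
  formula-step {s} {k} {ks} k≡1+s run IH u inj u0<b (k* , k*∈ , uk*≡b) =
    cases (toℕ (u fzero) <? toℕ (u k)) (<-cmp (toℕ (u k)) (toℕ b))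
    where
    open Step k≡1+s run IH u inj u0<b k*∈ uk*≡b
    cases : Dec (c < v) → Tri (v < B) (v ≡ B) (B < v) → total u (k ∷ ks) ≡ t ^ X * q
    cases (no  u0≮uk) _                = below-u0 u0≮uk
    cases (yes u0<uk) (tri< v<B _ _)   = between-u0-b u0<uk v<B
    cases (yes u0<uk) (tri≈ _ v≡B _)   = at-b u0<uk v≡B
    cases (yes u0<uk) (tri> _ _ B<v)   = above-b u0<uk B<v

  total-formula : ∀ {s ks} → Consecutive (suc s) ks → Formula s ks
  total-formula []            u inj u0<b (_ , () , _)
  total-formula (k≡1+s ∷ run) = formula-step k≡1+s run (total-formula run)

-- Proposition 5.3.  L and `chains w Γ` have the same members, the admissible T; the positions
-- of Γ^r(1,p) form the run p+1, p+2, …, and b = w(k*) with k* > p, so a < b and δ_ab = 0.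
proposition5p3 : (m : ℕ) (w : Permutation′ (suc m)) (b : Fin (suc m)) (p : ℕ) →
    (w ⟨$⟩ʳ fzero) ≤ᶠ b →
    p < toℕ (w ⟨$⟩ˡ b) →
    (L : List (List (Transp (suc m)))) → Unique L →
    (∀ T → (T ∈ L) ⇔ Adm m p (w ⟨$⟩ʳ_) b T) →
    (t : ℤ) →
    sumℤ (map (weight t (w ⟨$⟩ʳ_)) L)
      ≡ (t ^ Nseg (w ⟨$⟩ʳ_) 1 p (toℕ (w ⟨$⟩ʳ fzero)) (toℕ b))
        * ((⁺ 1 - t) ^ (1 ∸ δ (w ⟨$⟩ʳ fzero) b))
proposition5p3 m w b p a≤b p<k* L unique-L L≡Adm t = begin
  sumℤ (map (weight t u) L)        ≡⟨ sumℤ-same-members (weight t u) unique-L (chains-unique u (consecutive-unique run)) same ⟩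
  total u ks                       ≡⟨ total-formula run u injective a<b (k* , k*∈ks , inverseʳ w) ⟩
  t ^ N * (⁺ 1 - t)                ≡⟨ cong (t ^ N *_) (sym (ℤP.^-identityʳ (⁺ 1 - t))) ⟩
  t ^ N * ((⁺ 1 - t) ^ 1)          ≡⟨ cong (λ e → t ^ N * ((⁺ 1 - t) ^ (1 ∸ (if e then 1 else 0)))) (sym (dec-false (u fzero ≟ᶠ b) a≢b)) ⟩
  t ^ N * ((⁺ 1 - t) ^ (1 ∸ δ (u fzero) b)) ∎
  where
  open ≡-Reasoning
  open Enumeration b
  open TotalWeight b t
  u = w ⟨$⟩ʳ_
  k* = w ⟨$⟩ˡ b
  N = Nseg u 1 p (toℕ (u fzero)) (toℕ b)
  ks = filterᵇ (λ j → suc p ≤ᵇ toℕ j) (allFin (suc m))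
  run : Consecutive (suc p) ks
  run = consecutive-filter (consecutive-tabulate id (λ _ → refl)) z≤n
  same : ∀ {T} → T ∈ L ⇔ T ∈ chains u ks
  same {T} = mk⇔ (chains-complete u ks ∘ Equivalence.to (L≡Adm T)) (Equivalence.from (L≡Adm T) ∘ chains-sound u ks)
  injective : Injective _≡_ _≡_ u
  injective ui≡uj = trans (sym (inverseˡ w)) (trans (cong (w ⟨$⟩ˡ_) ui≡uj) (inverseˡ w))
  k*∈ks : k* ∈ ks
  k*∈ks = ∈-filter⁺ (λ j → T? (suc p ≤ᵇ toℕ j)) (∈-allFin k*) (≤⇒≤ᵇ p<k*)
  a≢b : u fzero ≢ b
  a≢b a≡b = n≮0 (subst (λ j → p < toℕ j) (trans (cong (w ⟨$⟩ˡ_) (sym a≡b)) (inverseˡ w)) p<k*)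
  a<b : toℕ (u fzero) < toℕ b
  a<b = ≤∧≢⇒< a≤b (a≢b ∘ toℕ-injective)
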